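{- For every integer $m\ge 1$ we have $S(m)=S(\kappa(m))$ and $R(m)=R(\kappa(m))$.
   Context: For $n\ge 1$, $\Phi_n(x)=\sum_{k=0}^{\varphi(n)} a(n,k)x^k$ denotes the $n$th cyclotomic polynomial, with $a(n,k)=0$ for $k>\varphi(n)$, and $c(n,k)$ are defined by $\frac{1}{\Phi_n(x)}=\sum_{k=0}^{\infty} c(n,k)x^k$ (Taylor expansion at $x=0$). For an integer $m\ge1$, $S(m)=\{ a(mn,k) \mid n\ge 1,\ k\ge 0\}$ and $R(m)=\{ c(mn,k) \mid n\ge 1,\ k\ge 0\}$. $\kappa(m)=\prod_{p\mid m}p$ (product over primes dividing $m$) denotes the squarefree kernel of $m$, i.e. its largest squarefree divisor. -}

module Defs where

open import Data.Nat as ℕ using (ℕ; zero; suc; _∸_; _≡ᵇ_)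
open import Data.Nat.Divisibility using (_∣?_)
open import Data.Nat.Primality using (prime?)
open import Data.Integer as ℤ using (ℤ; +_; -_; _+_; _*_)
open import Data.List using (List; []; _∷_; map; foldr; filter; upTo)
open import Data.Bool using (if_then_else_)
open import Data.Product using (Σ; _×_; ∃-syntax)
open import Relation.Nullary.Decidable using (_×-dec_)
open import Relation.Binary.PropositionalEquality using (_≡_)

Series : Set
Series = ℕ → ℤ

sumℤ : List ℤ → ℤ
sumℤ = foldr _+_ (+ 0)

_⊛_ : Series → Series → Series
(f ⊛ g) k = sumℤ (map (λ i → f i * g (k ∸ i)) (upTo (suc k)))

xPowMinusOne : ℕ → Series
xPowMinusOne n k =
  if k ≡ᵇ n then + 1 else (if k ≡ᵇ 0 then - (+ 1) else + 0)

-- Multiplicative inverse of a power series whose constant term f 0 is a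
-- unit of ℤ (i.e. ±1, so f 0 ⁻¹ = f 0).  With c the inverse:
--   c 0 = f 0 ,   c k = - f 0 * Σ_{i=1}^{k} f i * c (k - i).
-- invRev f k = [c k , c (k-1) , ... , c 0].
dotFrom : ℕ → Series → List ℤ → ℤ
dotFrom i f []       = + 0
dotFrom i f (c ∷ cs) = f i * c + dotFrom (suc i) f cs

invRev : Series → ℕ → List ℤ
invRev f zero    = f 0 ∷ []
invRev f (suc k) = - (f 0 * dotFrom 1 f r) ∷ r
  where r = invRev f k

headℤ : List ℤ → ℤ
headℤ []      = + 0
headℤ (c ∷ _) = c

inv : Series → Series
inv f k = headℤ (invRev f k)

-- Cyclotomic polynomials via  x^n - 1 = ∏_{d ∣ n} Φ_d(x)  (n ≥ 1), i.e.
--   Φ_n = (x^n - 1) · ∏_{d ∣ n, 1 ≤ d < n} Φ_d ⁻¹ .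
-- Recursion is structural on a fuel argument (fuel ≥ n suffices).

properDivisors : ℕ → List ℕ
properDivisors n = filter (λ d → d ∣? n) (map suc (upTo (n ∸ 1)))

cycFuel : ℕ → ℕ → Series
cycFuel zero       n = λ _ → + 0
cycFuel (suc fuel) n =
  foldr (λ d acc → acc ⊛ inv (cycFuel fuel d)) (xPowMinusOne n) (properDivisors n)

Φ : ℕ → Series
Φ n = cycFuel n n

-- a(n,k) and c(n,k)  (1/Φ_n(x) = Σ c(n,k) x^k; Φ_n(0) = ±1)
a : ℕ → ℕ → ℤ
a n k = Φ n k

c : ℕ → ℕ → ℤ
c n k = inv (Φ n) k

S : ℕ → ℤ → Set
S m z = ∃[ n ] ∃[ k ] (a (m ℕ.* suc n) k ≡ z)

R : ℕ → ℤ → Set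
R m z = ∃[ n ] ∃[ k ] (c (m ℕ.* suc n) k ≡ z)

κ : ℕ → ℕ
κ m = foldr ℕ._*_ 1 (filter (λ p → prime? p ×-dec p ∣? m) (upTo (suc m)))

module Submission where

-- Write m = t·k with k = κ(m).  Since mn = k·(tn), S(m) ⊆ S(k) and R(m) ⊆ R(k).  Conversely, the
-- coefficients for kn reappear for mn because Φ_{mn}(x) = Φ_{kn}(x^t): every prime factor of t
-- divides kn, and Φ_{np}(x) = Φ_n(x^p) whenever the prime p divides n.  Inverting power series
-- commutes with x ↦ x^t, so 1/Φ_{mn}(x) = (1/Φ_{kn})(x^t) as well.
--
-- Φ_{np}(x) = Φ_n(x^p) comes from x^n − 1 = ∏_{d ∣ n} Φ_d.  The divisors of np are the dp with
-- d ∣ n together with the d ∣ n prime to p, so Ψ_d = Φ_{dp} · Φ_d^{[p ∤ d]} satisfies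
-- ∏_{d ∣ n} Ψ_d = x^{np} − 1 = ∏_{d ∣ n} Φ_d(x^p) for all n.  Such products determine their
-- factors, hence Ψ_d = Φ_d(x^p), which for p ∣ d is the claim.

open import Algebra.Bundles using (CommutativeMonoid)
import Algebra.Properties.CommutativeSemigroup as CommutativeSemigroupProperties
open import Data.Bool using (Bool; if_then_else_)
open import Data.Empty using (⊥-elim)
open import Data.Integer as ℤ using (ℤ; +_; -_; _+_; _*_)
import Data.Integer.Properties as ℤ
open import Data.Integer.Tactic.RingSolver using (solve-∀)
open import Data.List using ([]; _∷_; map; foldr; filter; applyUpTo; upTo)
open import Data.List.Membership.Propositional.Properties using (∈-upTo⁺; ∈-filter⁺)
open import Data.List.Properties using (map-applyUpTo)
open import Data.List.Relation.Unary.All as All using (All; []; _∷_)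
open import Data.List.Relation.Unary.All.Properties using (all-filter)
open import Data.List.Relation.Unary.AllPairs using ([]; _∷_)
open import Data.List.Relation.Unary.Unique.Propositional using (Unique)
open import Data.List.Relation.Unary.Unique.Propositional.Properties using (upTo⁺; filter⁺)
open import Data.Nat as ℕ using (ℕ; zero; suc; _<_; _≤_; _≥_; z≤n; s≤s; NonZero)
import Data.Nat.Properties as ℕ
open import Data.Nat.Coprimality as Coprime using (Coprime; coprime-divisor)
open import Data.Nat.DivMod using (_/_; m*n/n≡m)
open import Data.Nat.Divisibility
  using (_∣_; _∣?_; divides; divides-refl; 1∣_; ∣-refl; ∣-trans; ∣⇒≤; m∣m*n; n∣m*n;
         ∣m+n∣m⇒∣n; ∣m∸n∣n⇒∣m; *-cancelʳ-∣; *-monoˡ-∣)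
open import Data.Nat.Induction using (<-rec)
open import Data.Nat.ListAction using (product)
open import Data.Nat.ListAction.Properties using (∈⇒∣product)
open import Data.Nat.Primality using (Prime; prime?; prime⇒irreducible; prime⇒nonZero; productOfPrimes≢0)
open import Data.Nat.Primality.Factorisation using (factorise; factorisationHasAllPrimeFactors)
import Data.Nat.Tactic.RingSolver as ℕ-Solver
open import Data.Product using (_,_; _×_; proj₁; proj₂)
open import Data.Sum using (_⊎_; inj₁; inj₂)
open import Function using (_∘_)
open import Function.Bundles using (_⇔_; mk⇔)
open import Level using (0ℓ)
open import Relation.Binary.PropositionalEquality as ≡ using (_≡_; _≗_)
import Relation.Binary.Reasoning.Setoid as SetoidReasoning
open import Relation.Nullary using (¬_; Dec; yes; no; ¬?)
open import Relation.Nullary.Decidable using (_×-dec_; does-⇔; dec-false)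
open import Relation.Unary using (Decidable)

open import Defs

-- Divisibility and the squarefree kernel

prime∤⇒coprime : ∀ {p n} → Prime p → ¬ p ∣ n → Coprime p n
prime∤⇒coprime p-prime p∤n (d∣p , d∣n) with prime⇒irreducible p-prime d∣p
... | inj₁ d≡1    = d≡1
... | inj₂ ≡.refl = ⊥-elim (p∤n d∣n)

∣-*-prime⇒∣ : ∀ {p d n} → Prime p → ¬ p ∣ d → d ∣ n ℕ.* p → d ∣ n
∣-*-prime⇒∣ {p} {d} {n} p-prime p∤d d∣np =
  coprime-divisor (Coprime.sym (prime∤⇒coprime p-prime p∤d)) (≡.subst (d ∣_) (ℕ.*-comm n p) d∣np)

coprime-*-∣ : ∀ {a b m} → Coprime a b → a ∣ m → b ∣ m → a ℕ.* b ∣ m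
coprime-*-∣ {a} {b} a⊥b (divides-refl k) b∣ka
  with divides-refl j ← coprime-divisor (Coprime.sym a⊥b) (≡.subst (b ∣_) (ℕ.*-comm k a) b∣ka) =
  divides j (reassoc j b a)
  where
  reassoc : ∀ j b a → j ℕ.* b ℕ.* a ≡ j ℕ.* (a ℕ.* b)
  reassoc = ℕ-Solver.solve-∀

product-distinct-primes-∣ : ∀ {ps m} → Unique ps → All Prime ps → All (_∣ m) ps → product ps ∣ m
product-distinct-primes-∣ {[]}     []            []                   []            = 1∣ _
product-distinct-primes-∣ {p ∷ ps} (p∉ps ∷ uniq) (p-prime ∷ ps-prime) (p∣m ∷ ps∣m) =
  coprime-*-∣ (prime∤⇒coprime p-prime p∤ps) p∣m (product-distinct-primes-∣ uniq ps-prime ps∣m)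
  where
  p∤ps : ¬ p ∣ product ps
  p∤ps p∣ps = All.lookup p∉ps (factorisationHasAllPrimeFactors p-prime p∣ps ps-prime) ≡.refl

module _ (m : ℕ) where

  private
    P? : Decidable (λ p → Prime p × p ∣ m)
    P? p = prime? p ×-dec p ∣? m

  κ∣ : κ m ∣ m
  κ∣ = product-distinct-primes-∣ (filter⁺ P? (upTo⁺ (suc m)))
         (All.map proj₁ (all-filter P? (upTo (suc m))))
         (All.map proj₂ (all-filter P? (upTo (suc m))))

  prime∣⇒∣κ : .{{_ : NonZero m}} → ∀ {q} → Prime q → q ∣ m → q ∣ κ m
  prime∣⇒∣κ q-prime q∣m = ∈⇒∣product (∈-filter⁺ P? (∈-upTo⁺ (s≤s (∣⇒≤ q∣m))) (q-prime , q∣m))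

-- Finite products in a commutative monoid

module FiniteProducts {c ℓ} (M : CommutativeMonoid c ℓ) where

  open CommutativeMonoid M
  open SetoidReasoning setoid
  open CommutativeSemigroupProperties commutativeSemigroup using (interchange)

  ∏ : ℕ → (ℕ → Carrier) → Carrier
  ∏ zero    F = ε
  ∏ (suc n) F = F 0 ∙ ∏ n (F ∘ suc)

  ∏-cong : ∀ n {F G : ℕ → Carrier} → (∀ i → i < n → F i ≈ G i) → ∏ n F ≈ ∏ n G
  ∏-cong zero    F≈G = refl
  ∏-cong (suc n) F≈G = ∙-cong (F≈G 0 (s≤s z≤n)) (∏-cong n (λ i i<n → F≈G (suc i) (s≤s i<n)))

  ∏-ε : ∀ n {F : ℕ → Carrier} → (∀ i → i < n → F i ≈ ε) → ∏ n F ≈ ε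
  ∏-ε zero    F≈ε = refl
  ∏-ε (suc n) F≈ε =
    trans (∙-cong (F≈ε 0 (s≤s z≤n)) (∏-ε n (λ i i<n → F≈ε (suc i) (s≤s i<n)))) (identityˡ ε)

  ∏-+ : ∀ m n (F : ℕ → Carrier) → ∏ (m ℕ.+ n) F ≈ ∏ m F ∙ ∏ n (λ i → F (m ℕ.+ i))
  ∏-+ zero    n F = sym (identityˡ _)
  ∏-+ (suc m) n F = trans (∙-congˡ (∏-+ m n (F ∘ suc))) (sym (assoc _ _ _))

  ∏-suc : ∀ n (F : ℕ → Carrier) → ∏ (suc n) F ≈ ∏ n F ∙ F n
  ∏-suc zero    F = trans (identityʳ _) (sym (identityˡ _))
  ∏-suc (suc n) F = trans (∙-congˡ (∏-suc n (F ∘ suc))) (sym (assoc _ _ _))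

  ∏-∙ : ∀ n (F G : ℕ → Carrier) → ∏ n (λ i → F i ∙ G i) ≈ ∏ n F ∙ ∏ n G
  ∏-∙ zero    F G = sym (identityˡ ε)
  ∏-∙ (suc n) F G = trans (∙-congˡ (∏-∙ n (F ∘ suc) (G ∘ suc))) (interchange _ _ _ _)

  ∏-last : ∀ n (F : ℕ → Carrier) → (∀ i → i < n → F i ≈ ε) → ∏ (suc n) F ≈ F n
  ∏-last n F F≈ε = trans (∏-suc n F) (trans (∙-congʳ (∏-ε n F≈ε)) (identityˡ _))

  ∏-multiples : ∀ p .{{_ : NonZero p}} q (F : ℕ → Carrier) → (∀ i → ¬ p ∣ i → F i ≈ ε) →
                ∏ (q ℕ.* p) (F ∘ suc) ≈ ∏ q (λ j → F (suc j ℕ.* p))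
  ∏-multiples p       zero    F F≈ε = refl
  ∏-multiples (suc p) (suc q) F F≈ε = begin
    ∏ (suc p ℕ.+ q ℕ.* suc p) (F ∘ suc)
      ≈⟨ ∏-+ (suc p) (q ℕ.* suc p) (F ∘ suc) ⟩
    ∏ (suc p) (F ∘ suc) ∙ ∏ (q ℕ.* suc p) (λ i → F (suc (suc p ℕ.+ i)))
      ≈⟨ ∙-cong (∏-last p (F ∘ suc) F[1+i]≈ε) (∏-cong (q ℕ.* suc p) shift) ⟩
    F (suc p) ∙ ∏ (q ℕ.* suc p) (λ i → F (suc p ℕ.+ suc i))
      ≈⟨ ∙-cong (reflexive (≡.cong F (≡.sym (ℕ.*-identityˡ (suc p)))))
                (∏-multiples (suc p) q (λ i → F (suc p ℕ.+ i)) F[p+i]≈ε) ⟩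
    F (1 ℕ.* suc p) ∙ ∏ q (λ j → F (suc p ℕ.+ suc j ℕ.* suc p))
      ∎
    where
    F[1+i]≈ε : ∀ i → i < p → F (suc i) ≈ ε
    F[1+i]≈ε i i<p = F≈ε (suc i) (λ p∣1+i → ℕ.<⇒≱ (s≤s i<p) (∣⇒≤ p∣1+i))
    shift : ∀ i → i < q ℕ.* suc p → F (suc (suc p ℕ.+ i)) ≈ F (suc p ℕ.+ suc i)
    shift i _ = reflexive (≡.cong F (≡.sym (ℕ.+-suc (suc p) i)))
    F[p+i]≈ε : ∀ i → ¬ suc p ∣ i → F (suc p ℕ.+ i) ≈ ε
    F[p+i]≈ε i p∤i = F≈ε (suc p ℕ.+ i) (λ p∣p+i → p∤i (∣m+n∣m⇒∣n p∣p+i ∣-refl))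

  when : ∀ {a} {P : Set a} → Dec P → Carrier → Carrier
  when (yes _) x = x
  when (no _)  _ = ε

  module _ {a} {P : Set a} where

    when-cong : ∀ (P? : Dec P) {x y} → (P → x ≈ y) → when P? x ≈ when P? y
    when-cong (yes p) x≈y = x≈y p
    when-cong (no _)  _   = refl

    when-yes : ∀ (P? : Dec P) {x} → P → when P? x ≈ x
    when-yes (yes _) _ = refl
    when-yes (no ¬p) p = ⊥-elim (¬p p)

    when-no : ∀ (P? : Dec P) {x} → ¬ P → when P? x ≈ ε
    when-no (yes p) ¬p = ⊥-elim (¬p p)
    when-no (no _)  _  = refl

    when-ε : ∀ (P? : Dec P) → when P? ε ≈ ε
    when-ε (yes _) = refl
    when-ε (no _)  = refl

    when-∙ : ∀ (P? : Dec P) x y → when P? x ∙ when P? y ≈ when P? (x ∙ y)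
    when-∙ (yes _) x y = refl
    when-∙ (no _)  x y = identityˡ ε

    when-split : ∀ (P? : Dec P) x → x ≈ when P? x ∙ when (¬? P?) x
    when-split (yes _) x = sym (identityʳ x)
    when-split (no _)  x = sym (identityˡ x)

    when-⇔ : ∀ {b} {Q : Set b} (P? : Dec P) (Q? : Dec Q) {x} → (P → Q) → (Q → P) →
             when P? x ≈ when Q? x
    when-⇔ (yes _) (yes _) _   _   = refl
    when-⇔ (no _)  (no _)  _   _   = refl
    when-⇔ (yes p) (no ¬q) P⇒Q _   = ⊥-elim (¬q (P⇒Q p))
    when-⇔ (no ¬p) (yes q) _   Q⇒P = ⊥-elim (¬p (Q⇒P q))

    when-comm : ∀ {b} {Q : Set b} (P? : Dec P) (Q? : Dec Q) x →
                when P? (when Q? x) ≈ when Q? (when P? x)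
    when-comm (yes _) _       x = refl
    when-comm (no _)  (yes _) x = refl
    when-comm (no _)  (no _)  x = refl

  foldr-filter : ∀ {P : ℕ → Set} (P? : Decidable P) (h : ℕ → Carrier) x g m →
                 foldr (λ d acc → acc ∙ h d) x (filter P? (applyUpTo g m)) ≈
                 x ∙ ∏ m (λ i → when (P? (g i)) (h (g i)))
  foldr-filter P? h x g zero    = sym (identityʳ x)
  foldr-filter P? h x g (suc m) with P? (g 0)
  ... | yes _ = begin
    foldr _ x (filter P? (applyUpTo (g ∘ suc) m)) ∙ h (g 0) ≈⟨ ∙-congʳ (foldr-filter P? h x (g ∘ suc) m) ⟩
    (x ∙ rest) ∙ h (g 0)                                   ≈⟨ assoc x rest (h (g 0)) ⟩
    x ∙ (rest ∙ h (g 0))                                   ≈⟨ ∙-congˡ (comm rest (h (g 0))) ⟩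
    x ∙ (h (g 0) ∙ rest)                                   ∎
    where
    rest : Carrier
    rest = ∏ m (λ i → when (P? (g (suc i))) (h (g (suc i))))
  ... | no _ = trans (foldr-filter P? h x (g ∘ suc) m) (∙-congˡ (sym (identityˡ _)))

  ∏∣ : ℕ → (ℕ → Carrier) → Carrier
  ∏∣ n F = ∏ n (λ i → when (suc i ∣? n) (F (suc i)))

  ∏∣′ : ℕ → (ℕ → Carrier) → Carrier
  ∏∣′ n F = ∏ (n ℕ.∸ 1) (λ i → when (suc i ∣? n) (F (suc i)))

  ∏∣′-cong : ∀ n {F G : ℕ → Carrier} → (∀ d → d < n → F (suc d) ≈ G (suc d)) →
             ∏∣′ (suc n) F ≈ ∏∣′ (suc n) G
  ∏∣′-cong n F≈G = ∏-cong n (λ d d<n → when-cong (suc d ∣? suc n) (λ _ → F≈G d d<n))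

  ∏∣′-∙ : ∀ n (F G : ℕ → Carrier) → ∏∣′ n F ∙ ∏∣′ n G ≈ ∏∣′ n (λ d → F d ∙ G d)
  ∏∣′-∙ n F G = trans (sym (∏-∙ (n ℕ.∸ 1) _ _)) (∏-cong (n ℕ.∸ 1) (λ i _ → when-∙ (suc i ∣? n) _ _))

  ∏∣′-ε : ∀ n (F : ℕ → Carrier) → (∀ d → F (suc d) ≈ ε) → ∏∣′ n F ≈ ε
  ∏∣′-ε n F F≈ε =
    ∏-ε (n ℕ.∸ 1) (λ d _ → trans (when-cong (suc d ∣? n) (λ _ → F≈ε d)) (when-ε (suc d ∣? n)))

  ∏∣-suc : ∀ n (F : ℕ → Carrier) → ∏∣ (suc n) F ≈ ∏∣′ (suc n) F ∙ F (suc n)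
  ∏∣-suc n F = trans (∏-suc n _) (∙-congˡ (when-yes (suc n ∣? suc n) ∣-refl))

  ∏∣-*-prime : ∀ {p} → Prime p → ∀ n .{{_ : NonZero n}} (F : ℕ → Carrier) →
               ∏∣ (n ℕ.* p) F ≈ ∏∣ n (λ d → F (d ℕ.* p) ∙ when (¬? (p ∣? d)) (F d))
  ∏∣-*-prime {p} p-prime n F = begin
    ∏∣ N F
      ≈⟨ ∏-cong N (λ i _ → split (suc i)) ⟩
    ∏ N (λ i → A (suc i) ∙ B (suc i))
      ≈⟨ ∏-∙ N (A ∘ suc) (B ∘ suc) ⟩
    ∏ N (A ∘ suc) ∙ ∏ N (B ∘ suc)
      ≈⟨ ∙-cong multiples nonMultiples ⟩
    ∏ n (λ j → when (suc j ∣? n) (F (suc j ℕ.* p))) ∙ ∏ n (B ∘ suc)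
      ≈⟨ sym (∏-∙ n _ (B ∘ suc)) ⟩
    ∏ n (λ j → when (suc j ∣? n) (F (suc j ℕ.* p)) ∙ B (suc j))
      ≈⟨ ∏-cong n (λ j _ → combine (suc j)) ⟩
    ∏∣ n (λ d → F (d ℕ.* p) ∙ when (¬? (p ∣? d)) (F d))
      ∎
    where
    instance
      p≢0 : NonZero p
      p≢0 = prime⇒nonZero p-prime
    N : ℕ
    N = n ℕ.* p
    A B : ℕ → Carrier
    A e = when (p ∣? e) (when (e ∣? N) (F e))
    B e = when (¬? (p ∣? e)) (when (e ∣? n) (F e))

    split : ∀ e → when (e ∣? N) (F e) ≈ A e ∙ B e
    split e = trans (when-split (p ∣? e) _) (∙-congˡ (when-cong (¬? (p ∣? e)) (λ p∤e →
      when-⇔ (e ∣? N) (e ∣? n) (∣-*-prime⇒∣ p-prime p∤e) (λ e∣n → ∣-trans e∣n (m∣m*n p)))))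

    multiples : ∏ N (A ∘ suc) ≈ ∏ n (λ j → when (suc j ∣? n) (F (suc j ℕ.* p)))
    multiples = trans (∏-multiples p n A (λ i p∤i → when-no (p ∣? i) p∤i)) (∏-cong n (λ j _ →
      trans (when-yes (p ∣? suc j ℕ.* p) (n∣m*n (suc j)))
            (when-⇔ (suc j ℕ.* p ∣? N) (suc j ∣? n) (*-cancelʳ-∣ p) (*-monoˡ-∣ p))))

    nonMultiples : ∏ N (B ∘ suc) ≈ ∏ n (B ∘ suc)
    nonMultiples = begin
      ∏ N (B ∘ suc)
        ≡⟨ ≡.cong (λ k → ∏ k (B ∘ suc)) (≡.sym (ℕ.m+[n∸m]≡n (ℕ.m≤m*n n p))) ⟩
      ∏ (n ℕ.+ (N ℕ.∸ n)) (B ∘ suc)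
        ≈⟨ ∏-+ n (N ℕ.∸ n) (B ∘ suc) ⟩
      ∏ n (B ∘ suc) ∙ ∏ (N ℕ.∸ n) (λ i → B (suc (n ℕ.+ i)))
        ≈⟨ ∙-congˡ (∏-ε (N ℕ.∸ n) (λ i _ → B[1+n+i]≈ε i)) ⟩
      ∏ n (B ∘ suc) ∙ ε
        ≈⟨ identityʳ _ ⟩
      ∏ n (B ∘ suc)
        ∎
      where
      B[1+n+i]≈ε : ∀ i → B (suc (n ℕ.+ i)) ≈ ε
      B[1+n+i]≈ε i = trans
        (when-cong (¬? (p ∣? suc (n ℕ.+ i))) (λ _ →
          when-no (suc (n ℕ.+ i) ∣? n) (λ d∣n → ℕ.<⇒≱ (s≤s (ℕ.m≤m+n n i)) (∣⇒≤ d∣n))))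
        (when-ε (¬? (p ∣? suc (n ℕ.+ i))))

    combine : ∀ d → when (d ∣? n) (F (d ℕ.* p)) ∙ B d ≈
                    when (d ∣? n) (F (d ℕ.* p) ∙ when (¬? (p ∣? d)) (F d))
    combine d = trans (∙-congˡ (when-comm (¬? (p ∣? d)) (d ∣? n) (F d))) (when-∙ (d ∣? n) _ _)

-- The monoid of power series under ⊛

open ≡ using (refl; cong; cong₂)
open FiniteProducts ℤ.+-0-commutativeMonoid using ()
  renaming (∏ to ∑; ∏-cong to ∑-cong; ∏-ε to ∑-0; ∏-multiples to ∑-multiples)
open CommutativeSemigroupProperties ℤ.+-commutativeSemigroup using ()
  renaming (x∙yz≈y∙xz to x+[y+z]≡y+[x+z])

sumℤ-applyUpTo : ∀ (F : ℕ → ℤ) g n → sumℤ (map F (applyUpTo g n)) ≡ ∑ n (F ∘ g)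
sumℤ-applyUpTo F g zero    = refl
sumℤ-applyUpTo F g (suc n) = cong (_+_ (F (g 0))) (sumℤ-applyUpTo F (g ∘ suc) n)

⊛-∑ : ∀ f g k → (f ⊛ g) k ≡ ∑ (suc k) (λ i → f i * g (k ℕ.∸ i))
⊛-∑ f g k = sumℤ-applyUpTo (λ i → f i * g (k ℕ.∸ i)) (λ i → i) (suc k)

shift : Series → Series
shift f i = f (suc i)

-- ⊛ by recursion on the first factor; the monoid laws are proved in this form.
conv : Series → Series → Series
conv f g zero    = f 0 * g 0
conv f g (suc k) = f 0 * g (suc k) + conv (shift f) g k

conv-∑ : ∀ f g k → conv f g k ≡ ∑ (suc k) (λ i → f i * g (k ℕ.∸ i))
conv-∑ f g zero    = ≡.sym (ℤ.+-identityʳ _)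
conv-∑ f g (suc k) = cong (_+_ (f 0 * g (suc k))) (conv-∑ (shift f) g k)

⊛≗conv : ∀ f g → f ⊛ g ≗ conv f g
⊛≗conv f g k = ≡.trans (⊛-∑ f g k) (≡.sym (conv-∑ f g k))

conv-cong : ∀ {f f′ g g′} → f ≗ f′ → g ≗ g′ → conv f g ≗ conv f′ g′
conv-cong f≗f′ g≗g′ zero    = cong₂ _*_ (f≗f′ 0) (g≗g′ 0)
conv-cong f≗f′ g≗g′ (suc k) =
  cong₂ _+_ (cong₂ _*_ (f≗f′ 0) (g≗g′ (suc k))) (conv-cong (f≗f′ ∘ suc) g≗g′ k)

conv-sucʳ : ∀ f g k → conv f g (suc k) ≡ g 0 * f (suc k) + conv f (shift g) k
conv-sucʳ f g zero    = swap (f 0) (g 1) (f 1) (g 0)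
  where
  swap : ∀ a b c d → a * b + c * d ≡ d * c + a * b
  swap = solve-∀
conv-sucʳ f g (suc k) = begin
  f 0 * g (2 ℕ.+ k) + conv (shift f) g (suc k)
    ≡⟨ cong (_+_ (f 0 * g (2 ℕ.+ k))) (conv-sucʳ (shift f) g k) ⟩
  f 0 * g (2 ℕ.+ k) + (g 0 * f (2 ℕ.+ k) + conv (shift f) (shift g) k)
    ≡⟨ x+[y+z]≡y+[x+z] (f 0 * g (2 ℕ.+ k)) (g 0 * f (2 ℕ.+ k)) (conv (shift f) (shift g) k) ⟩
  g 0 * f (2 ℕ.+ k) + (f 0 * g (2 ℕ.+ k) + conv (shift f) (shift g) k)
    ∎
  where open ≡.≡-Reasoning

conv-comm : ∀ f g → conv f g ≗ conv g f
conv-comm f g zero    = ℤ.*-comm (f 0) (g 0)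
conv-comm f g (suc k) =
  ≡.trans (conv-sucʳ f g k) (cong (_+_ (g 0 * f (suc k))) (conv-comm f (shift g) k))

conv-linearˡ : ∀ a u v h → conv (λ i → a * u i + v i) h ≗ (λ k → a * conv u h k + conv v h k)
conv-linearˡ a u v h zero    = distrib a (u 0) (v 0) (h 0)
  where
  distrib : ∀ a x y z → (a * x + y) * z ≡ a * (x * z) + y * z
  distrib = solve-∀
conv-linearˡ a u v h (suc k) = ≡.trans
  (cong (_+_ ((a * u 0 + v 0) * h (suc k))) (conv-linearˡ a (shift u) (shift v) h k))
  (distrib a (u 0) (v 0) (h (suc k)) (conv (shift u) h k) (conv (shift v) h k))
  where
  distrib : ∀ a x y z s t → (a * x + y) * z + (a * s + t) ≡ a * (x * z + s) + (y * z + t)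
  distrib = solve-∀

conv-assoc : ∀ f g h → conv (conv f g) h ≗ conv f (conv g h)
conv-assoc f g h zero    = ℤ.*-assoc (f 0) (g 0) (h 0)
conv-assoc f g h (suc k) = begin
  (f 0 * g 0) * h (suc k) + conv (shift (conv f g)) h k
    ≡⟨ cong (_+_ ((f 0 * g 0) * h (suc k))) (conv-linearˡ (f 0) (shift g) (conv (shift f) g) h k) ⟩
  (f 0 * g 0) * h (suc k) + (f 0 * conv (shift g) h k + conv (conv (shift f) g) h k)
    ≡⟨ cong (λ z → (f 0 * g 0) * h (suc k) + (f 0 * conv (shift g) h k + z))
            (conv-assoc (shift f) g h k) ⟩
  (f 0 * g 0) * h (suc k) + (f 0 * conv (shift g) h k + conv (shift f) (conv g h) k)
    ≡⟨ regroup (f 0) (g 0) (h (suc k)) (conv (shift g) h k) (conv (shift f) (conv g h) k) ⟩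
  f 0 * (g 0 * h (suc k) + conv (shift g) h k) + conv (shift f) (conv g h) k
    ∎
  where
  open ≡.≡-Reasoning
  regroup : ∀ x y z s t → (x * y) * z + (x * s + t) ≡ x * (y * z + s) + t
  regroup = solve-∀

one : Series
one zero    = + 1
one (suc _) = + 0

one-+ : ∀ m .{{_ : NonZero m}} n → one (m ℕ.+ n) ≡ + 0
one-+ (suc m) n = refl

conv-oneˡ : ∀ g → conv one g ≗ g
conv-oneˡ g zero    = ℤ.*-identityˡ (g 0)
conv-oneˡ g (suc k) = ≡.trans (cong₂ _+_ (ℤ.*-identityˡ (g (suc k))) (conv-zeroˡ k)) (ℤ.+-identityʳ _)
  where
  conv-zeroˡ : ∀ k → conv (λ _ → + 0) g k ≡ + 0
  conv-zeroˡ zero    = refl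
  conv-zeroˡ (suc k) = ≡.trans (ℤ.+-identityˡ _) (conv-zeroˡ k)

module _ where
  open ≡.≡-Reasoning

  ⊛-cong : ∀ {f f′ g g′} → f ≗ f′ → g ≗ g′ → f ⊛ g ≗ f′ ⊛ g′
  ⊛-cong {f} {f′} {g} {g′} f≗f′ g≗g′ k = begin
    (f ⊛ g) k     ≡⟨ ⊛≗conv f g k ⟩
    conv f g k    ≡⟨ conv-cong f≗f′ g≗g′ k ⟩
    conv f′ g′ k  ≡⟨ ⊛≗conv f′ g′ k ⟨
    (f′ ⊛ g′) k   ∎

  ⊛-assoc : ∀ f g h → (f ⊛ g) ⊛ h ≗ f ⊛ (g ⊛ h)
  ⊛-assoc f g h k = begin
    ((f ⊛ g) ⊛ h) k       ≡⟨ ⊛≗conv (f ⊛ g) h k ⟩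
    conv (f ⊛ g) h k      ≡⟨ conv-cong (⊛≗conv f g) (λ _ → refl) k ⟩
    conv (conv f g) h k   ≡⟨ conv-assoc f g h k ⟩
    conv f (conv g h) k   ≡⟨ conv-cong (λ _ → refl) (⊛≗conv g h) k ⟨
    conv f (g ⊛ h) k      ≡⟨ ⊛≗conv f (g ⊛ h) k ⟨
    (f ⊛ (g ⊛ h)) k       ∎

  ⊛-comm : ∀ f g → f ⊛ g ≗ g ⊛ f
  ⊛-comm f g k = begin
    (f ⊛ g) k   ≡⟨ ⊛≗conv f g k ⟩
    conv f g k  ≡⟨ conv-comm f g k ⟩
    conv g f k  ≡⟨ ⊛≗conv g f k ⟨
    (g ⊛ f) k   ∎

⊛-identityˡ : ∀ g → one ⊛ g ≗ g
⊛-identityˡ g k = ≡.trans (⊛≗conv one g k) (conv-oneˡ g k)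

⊛-identityʳ : ∀ g → g ⊛ one ≗ g
⊛-identityʳ g k = ≡.trans (⊛-comm g one k) (⊛-identityˡ g k)

⊛-commutativeMonoid : CommutativeMonoid 0ℓ 0ℓ
⊛-commutativeMonoid = record
  { Carrier             = Series
  ; _≈_                 = _≗_
  ; _∙_                 = _⊛_
  ; ε                   = one
  ; isCommutativeMonoid = record
    { isMonoid = record
      { isSemigroup = record
        { isMagma = record
          { isEquivalence = record
            { refl  = λ _ → refl
            ; sym   = λ f≗g k → ≡.sym (f≗g k)
            ; trans = λ f≗g g≗h k → ≡.trans (f≗g k) (g≗h k)
            }
          ; ∙-cong = ⊛-cong
          }
        ; assoc = ⊛-assoc
        }
      ; identity = ⊛-identityˡ , ⊛-identityʳ
      }
    ; comm = ⊛-comm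
    }
  }

open FiniteProducts ⊛-commutativeMonoid
open CommutativeMonoid ⊛-commutativeMonoid using ()
  renaming (refl to ≗-refl; sym to ≗-sym; trans to ≗-trans; reflexive to ≗-reflexive;
            ∙-congˡ to ⊛-congˡ; ∙-congʳ to ⊛-congʳ; setoid to ≗-setoid;
            commutativeSemigroup to ⊛-commutativeSemigroup)
open CommutativeSemigroupProperties ⊛-commutativeSemigroup using ()
  renaming (x∙yz≈y∙xz to x⊛[y⊛z]≗y⊛[x⊛z])
module ≗-Reasoning = SetoidReasoning ≗-setoid

IsUnit : ℤ → Set
IsUnit z = z ≡ + 1 ⊎ z ≡ - + 1

IsUnit⇒square≡1 : ∀ {z} → IsUnit z → z * z ≡ + 1
IsUnit⇒square≡1 (inj₁ refl) = refl
IsUnit⇒square≡1 (inj₂ refl) = refl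

IsUnit-* : ∀ {y z} → IsUnit y → IsUnit z → IsUnit (y * z)
IsUnit-* (inj₁ refl) (inj₁ refl) = inj₁ refl
IsUnit-* (inj₁ refl) (inj₂ refl) = inj₂ refl
IsUnit-* (inj₂ refl) (inj₁ refl) = inj₂ refl
IsUnit-* (inj₂ refl) (inj₂ refl) = inj₁ refl

IsUnit-⊛ : ∀ f g → IsUnit (f 0) → IsUnit (g 0) → IsUnit ((f ⊛ g) 0)
IsUnit-⊛ f g u v = ≡.subst IsUnit (≡.sym (⊛≗conv f g 0)) (IsUnit-* u v)

IsUnit-when : ∀ {a} {P : Set a} (P? : Dec P) f → IsUnit (f 0) → IsUnit (when P? f 0)
IsUnit-when (yes _) _ u = u
IsUnit-when (no _)  _ _ = inj₁ refl

IsUnit-∏ : ∀ n (F : ℕ → Series) → (∀ i → i < n → IsUnit (F i 0)) → IsUnit (∏ n F 0)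
IsUnit-∏ zero    F _ = inj₁ refl
IsUnit-∏ (suc n) F u = IsUnit-⊛ (F 0) (∏ n (F ∘ suc))
  (u 0 (s≤s z≤n)) (IsUnit-∏ n (F ∘ suc) (λ i i<n → u (suc i) (s≤s i<n)))

dotFrom-∑ : ∀ f j k → dotFrom j f (invRev f k) ≡ ∑ (suc k) (λ i → f (j ℕ.+ i) * inv f (k ℕ.∸ i))
dotFrom-∑ f j zero    = cong (λ i → f i * f 0 + + 0) (≡.sym (ℕ.+-identityʳ j))
dotFrom-∑ f j (suc k) = cong₂ _+_
  (cong (λ i → f i * inv f (suc k)) (≡.sym (ℕ.+-identityʳ j)))
  (≡.trans (dotFrom-∑ f (suc j) k)
           (∑-cong (suc k) (λ i _ → cong (λ i′ → f i′ * inv f (k ℕ.∸ i)) (≡.sym (ℕ.+-suc j i)))))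

⊛-inverseʳ : ∀ f → IsUnit (f 0) → f ⊛ inv f ≗ one
⊛-inverseʳ f u zero    = ≡.trans (⊛≗conv f (inv f) 0) (IsUnit⇒square≡1 u)
⊛-inverseʳ f u (suc k) = begin
  (f ⊛ inv f) (suc k)          ≡⟨ ⊛-∑ f (inv f) (suc k) ⟩
  f 0 * inv f (suc k) + D      ≡⟨ cong (λ z → f 0 * - (f 0 * z) + D) (dotFrom-∑ f 1 k) ⟩
  f 0 * - (f 0 * D) + D        ≡⟨ factor (f 0) D ⟩
  (+ 1 + - (f 0 * f 0)) * D    ≡⟨ cong (λ z → (+ 1 + - z) * D) (IsUnit⇒square≡1 u) ⟩
  + 0                          ∎
  where
  open ≡.≡-Reasoning
  D : ℤ
  D = ∑ (suc k) (λ i → f (suc i) * inv f (k ℕ.∸ i))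
  factor : ∀ a d → a * - (a * d) + d ≡ (+ 1 + - (a * a)) * d
  factor = solve-∀

⊛-inverseˡ : ∀ f → IsUnit (f 0) → inv f ⊛ f ≗ one
⊛-inverseˡ f u = ≗-trans (⊛-comm (inv f) f) (⊛-inverseʳ f u)

inv-cong : ∀ {f g} → f ≗ g → inv f ≗ inv g
inv-cong {f} {g} f≗g k = cong headℤ (invRev-cong k)
  where
  dotFrom-cong : ∀ j xs → dotFrom j f xs ≡ dotFrom j g xs
  dotFrom-cong j []       = refl
  dotFrom-cong j (x ∷ xs) = cong₂ _+_ (cong (_* x) (f≗g j)) (dotFrom-cong (suc j) xs)
  invRev-cong : ∀ k → invRev f k ≡ invRev g k
  invRev-cong zero    = cong (_∷ []) (f≗g 0)
  invRev-cong (suc k) rewrite invRev-cong k | f≗g 0 | dotFrom-cong 1 (invRev g k) = refl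

⊛-cancelˡ : ∀ h {f g} → IsUnit (h 0) → h ⊛ f ≗ h ⊛ g → f ≗ g
⊛-cancelˡ h {f} {g} u hf≗hg = begin
  f                  ≈⟨ ⊛-identityˡ f ⟨
  one ⊛ f            ≈⟨ ⊛-congʳ (⊛-inverseˡ h u) ⟨
  (inv h ⊛ h) ⊛ f    ≈⟨ ⊛-assoc (inv h) h f ⟩
  inv h ⊛ (h ⊛ f)    ≈⟨ ⊛-congˡ {inv h} hf≗hg ⟩
  inv h ⊛ (h ⊛ g)    ≈⟨ ⊛-assoc (inv h) h g ⟨
  (inv h ⊛ h) ⊛ g    ≈⟨ ⊛-congʳ (⊛-inverseˡ h u) ⟩
  one ⊛ g            ≈⟨ ⊛-identityˡ g ⟩
  g                  ∎
  where open ≗-Reasoning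

inv-unique : ∀ f g → IsUnit (g 0) → f ⊛ g ≗ one → f ≗ inv g
inv-unique f g u fg≗1 =
  ⊛-cancelˡ g {f} {inv g} u (≗-trans (⊛-comm g f) (≗-trans fg≗1 (≗-sym (⊛-inverseʳ g u))))

-- Dilation: dilate t f is the series f(x^t)

dilate : (t : ℕ) .{{_ : NonZero t}} → Series → Series
dilate t f k with t ∣? k
... | yes _ = f (k / t)
... | no _  = + 0

module _ (t : ℕ) .{{_ : NonZero t}} where

  dilate-* : ∀ f j → dilate t f (j ℕ.* t) ≡ f j
  dilate-* f j with t ∣? j ℕ.* t
  ... | yes _ = cong f (m*n/n≡m j t)
  ... | no t∤ = ⊥-elim (t∤ (n∣m*n j))

  dilate-∤ : ∀ f {k} → ¬ t ∣ k → dilate t f k ≡ + 0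
  dilate-∤ f {k} t∤k with t ∣? k
  ... | yes t∣k = ⊥-elim (t∤k t∣k)
  ... | no _    = refl

  dilate-unique : ∀ f g → (∀ j → g (j ℕ.* t) ≡ f j) → (∀ k → ¬ t ∣ k → g k ≡ + 0) →
                  dilate t f ≗ g
  dilate-unique f g on off k with t ∣? k
  ... | yes (divides-refl j) = ≡.trans (cong f (m*n/n≡m j t)) (≡.sym (on j))
  ... | no t∤k               = ≡.sym (off k t∤k)

  dilate-cong : ∀ {f g} → f ≗ g → dilate t f ≗ dilate t g
  dilate-cong {f} {g} f≗g =
    dilate-unique f (dilate t g) (λ j → ≡.trans (dilate-* g j) (≡.sym (f≗g j))) (λ _ → dilate-∤ g)

  dilate-one : dilate t one ≗ one
  dilate-one = dilate-unique one one on off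
    where
    on : ∀ j → one (j ℕ.* t) ≡ one j
    on zero    = refl
    on (suc j) = one-+ t (j ℕ.* t)
    off : ∀ k → ¬ t ∣ k → one k ≡ + 0
    off zero    t∤0 = ⊥-elim (t∤0 (divides 0 refl))
    off (suc k) _   = refl

  dilate-⊛ : ∀ f g → dilate t (f ⊛ g) ≗ dilate t f ⊛ dilate t g
  dilate-⊛ f g = dilate-unique (f ⊛ g) (dilate t f ⊛ dilate t g) on off
    where
    term : ℕ → ℕ → ℤ
    term k i = dilate t f i * dilate t g (k ℕ.∸ i)

    on : ∀ j → (dilate t f ⊛ dilate t g) (j ℕ.* t) ≡ (f ⊛ g) j
    on j = begin
      (dilate t f ⊛ dilate t g) (j ℕ.* t)
        ≡⟨ ⊛-∑ (dilate t f) (dilate t g) (j ℕ.* t) ⟩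
      ∑ (suc (j ℕ.* t)) (term (j ℕ.* t))
        ≡⟨ cong (_+_ (term (j ℕ.* t) 0)) (∑-multiples t j (term (j ℕ.* t)) term≡0) ⟩
      ∑ (suc j) (λ i → term (j ℕ.* t) (i ℕ.* t))
        ≡⟨ ∑-cong (suc j) (λ i _ → cong₂ _*_ (dilate-* f i) (dilate-*-∸ i)) ⟩
      ∑ (suc j) (λ i → f i * g (j ℕ.∸ i))
        ≡⟨ ⊛-∑ f g j ⟨
      (f ⊛ g) j
        ∎
      where
      open ≡.≡-Reasoning
      term≡0 : ∀ i → ¬ t ∣ i → term (j ℕ.* t) i ≡ + 0
      term≡0 i t∤i = cong (_* dilate t g (j ℕ.* t ℕ.∸ i)) (dilate-∤ f t∤i)
      dilate-*-∸ : ∀ i → dilate t g (j ℕ.* t ℕ.∸ i ℕ.* t) ≡ g (j ℕ.∸ i)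
      dilate-*-∸ i = ≡.trans (cong (dilate t g) (≡.sym (ℕ.*-distribʳ-∸ t j i))) (dilate-* g (j ℕ.∸ i))

    off : ∀ k → ¬ t ∣ k → (dilate t f ⊛ dilate t g) k ≡ + 0
    off k t∤k = ≡.trans (⊛-∑ (dilate t f) (dilate t g) k)
                        (∑-0 (suc k) (λ i i≤k → term≡0 i (ℕ.≤-pred i≤k) (t ∣? i)))
      where
      term≡0 : ∀ i → i ≤ k → Dec (t ∣ i) → term k i ≡ + 0
      term≡0 i i≤k (no t∤i)  = cong (_* dilate t g (k ℕ.∸ i)) (dilate-∤ f t∤i)
      term≡0 i i≤k (yes t∣i) = ≡.trans
        (cong (dilate t f i *_) (dilate-∤ g (λ t∣k∸i → t∤k (∣m∸n∣n⇒∣m t i≤k t∣k∸i t∣i))))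
        (ℤ.*-zeroʳ (dilate t f i))

  dilate-∏ : ∀ n (F : ℕ → Series) → dilate t (∏ n F) ≗ ∏ n (dilate t ∘ F)
  dilate-∏ zero    F = dilate-one
  dilate-∏ (suc n) F =
    ≗-trans (dilate-⊛ (F 0) (∏ n (F ∘ suc))) (⊛-congˡ {dilate t (F 0)} (dilate-∏ n (F ∘ suc)))

  dilate-when : ∀ {a} {P : Set a} (P? : Dec P) f → dilate t (when P? f) ≗ when P? (dilate t f)
  dilate-when (yes _) f = ≗-refl
  dilate-when (no _)  f = dilate-one

  dilate-∏∣ : ∀ n (F : ℕ → Series) → dilate t (∏∣ n F) ≗ ∏∣ n (dilate t ∘ F)
  dilate-∏∣ n F = ≗-trans (dilate-∏ n _) (∏-cong n (λ i _ → dilate-when (suc i ∣? n) (F (suc i))))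

  dilate-inv : ∀ f → IsUnit (f 0) → dilate t (inv f) ≗ inv (dilate t f)
  dilate-inv f u = inv-unique (dilate t (inv f)) (dilate t f) dilated-unit (begin
    dilate t (inv f) ⊛ dilate t f   ≈⟨ dilate-⊛ (inv f) f ⟨
    dilate t (inv f ⊛ f)            ≈⟨ dilate-cong (⊛-inverseˡ f u) ⟩
    dilate t one                    ≈⟨ dilate-one ⟩
    one                             ∎)
    where
    open ≗-Reasoning
    dilated-unit : IsUnit (dilate t f 0)
    dilated-unit = ≡.subst IsUnit (≡.sym (dilate-* f 0)) u

  dilate-xPowMinusOne : ∀ n → dilate t (xPowMinusOne n) ≗ xPowMinusOne (n ℕ.* t)
  dilate-xPowMinusOne n = dilate-unique (xPowMinusOne n) (xPowMinusOne (n ℕ.* t)) on off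
    where
    X : Bool → Bool → ℤ
    X b b′ = if b then + 1 else (if b′ then - + 1 else + 0)
    *t-injective : ∀ {i j} → i ℕ.* t ≡ j ℕ.* t ⇔ i ≡ j
    *t-injective {i} {j} = mk⇔ (ℕ.*-cancelʳ-≡ i j t) (cong (ℕ._* t))
    on : ∀ j → xPowMinusOne (n ℕ.* t) (j ℕ.* t) ≡ xPowMinusOne n j
    on j = cong₂ X (does-⇔ *t-injective (j ℕ.* t ℕ.≟ n ℕ.* t) (j ℕ.≟ n))
                   (does-⇔ *t-injective (j ℕ.* t ℕ.≟ 0) (j ℕ.≟ 0))
    off : ∀ k → ¬ t ∣ k → xPowMinusOne (n ℕ.* t) k ≡ + 0
    off k t∤k = cong₂ X (dec-false (k ℕ.≟ n ℕ.* t) (λ k≡nt → t∤k (divides n k≡nt)))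
                        (dec-false (k ℕ.≟ 0) (λ k≡0 → t∤k (divides 0 k≡0)))

dilate-1 : ∀ f → dilate 1 f ≗ f
dilate-1 f = dilate-unique 1 f f (λ j → cong f (ℕ.*-identityʳ j)) (λ k 1∤k → ⊥-elim (1∤k (1∣ k)))

dilate-dilate : ∀ s t .{{_ : NonZero s}} .{{_ : NonZero t}} f →
                dilate s (dilate t f) ≗ dilate (t ℕ.* s) {{ℕ.m*n≢0 t s}} f
dilate-dilate s t f = ≗-sym
  (dilate-unique (t ℕ.* s) {{ℕ.m*n≢0 t s}} f (dilate s (dilate t f)) on (λ k ts∤k → off k ts∤k (s ∣? k)))
  where
  on : ∀ j → dilate s (dilate t f) (j ℕ.* (t ℕ.* s)) ≡ f j
  on j = begin
    dilate s (dilate t f) (j ℕ.* (t ℕ.* s))  ≡⟨ cong (dilate s (dilate t f)) (≡.sym (ℕ.*-assoc j t s)) ⟩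
    dilate s (dilate t f) (j ℕ.* t ℕ.* s)    ≡⟨ dilate-* s (dilate t f) (j ℕ.* t) ⟩
    dilate t f (j ℕ.* t)                     ≡⟨ dilate-* t f j ⟩
    f j                                      ∎
    where open ≡.≡-Reasoning
  off : ∀ k → ¬ t ℕ.* s ∣ k → Dec (s ∣ k) → dilate s (dilate t f) k ≡ + 0
  off k ts∤k (no s∤k)               = dilate-∤ s (dilate t f) s∤k
  off k ts∤k (yes (divides-refl q)) =
    ≡.trans (dilate-* s (dilate t f) q) (dilate-∤ t f (λ t∣q → ts∤k (*-monoˡ-∣ s t∣q)))

-- Cyclotomic polynomials

cycFuel-unfold : ∀ fuel n → cycFuel (suc fuel) n ≗ xPowMinusOne n ⊛ ∏∣′ n (inv ∘ cycFuel fuel)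
cycFuel-unfold fuel n rewrite map-applyUpTo (λ i → i) suc (n ℕ.∸ 1) =
  foldr-filter (_∣? n) (inv ∘ cycFuel fuel) (xPowMinusOne n) suc (n ℕ.∸ 1)

cycFuel-irrelevant : ∀ n fuel fuel′ → suc n ≤ fuel → suc n ≤ fuel′ →
                     cycFuel fuel (suc n) ≗ cycFuel fuel′ (suc n)
cycFuel-irrelevant n (suc fuel) (suc fuel′) (s≤s n≤fuel) (s≤s n≤fuel′) = begin
  cycFuel (suc fuel) (suc n)                                ≈⟨ cycFuel-unfold fuel (suc n) ⟩
  xPowMinusOne (suc n) ⊛ ∏∣′ (suc n) (inv ∘ cycFuel fuel)   ≈⟨ ⊛-congˡ {xPowMinusOne (suc n)} same-product ⟩
  xPowMinusOne (suc n) ⊛ ∏∣′ (suc n) (inv ∘ cycFuel fuel′)  ≈⟨ cycFuel-unfold fuel′ (suc n) ⟨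
  cycFuel (suc fuel′) (suc n)                               ∎
  where
  open ≗-Reasoning
  same-product : ∏∣′ (suc n) (inv ∘ cycFuel fuel) ≗ ∏∣′ (suc n) (inv ∘ cycFuel fuel′)
  same-product = ∏∣′-cong n {inv ∘ cycFuel fuel} {inv ∘ cycFuel fuel′} (λ d d<n →
    inv-cong (cycFuel-irrelevant d fuel fuel′ (ℕ.≤-trans d<n n≤fuel) (ℕ.≤-trans d<n n≤fuel′)))

Φ-unfold : ∀ n → Φ (suc n) ≗ xPowMinusOne (suc n) ⊛ ∏∣′ (suc n) (inv ∘ Φ)
Φ-unfold n = ≗-trans (cycFuel-unfold n (suc n)) (⊛-congˡ {xPowMinusOne (suc n)}
  (∏∣′-cong n {inv ∘ cycFuel n} {inv ∘ Φ} (λ d d<n →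
    inv-cong (cycFuel-irrelevant d n (suc d) d<n ℕ.≤-refl))))

IsUnit-Φ : ∀ n .{{_ : NonZero n}} → IsUnit (Φ n 0)
IsUnit-Φ (suc n) = <-rec (λ n → IsUnit (Φ (suc n) 0)) step n
  where
  step : ∀ n → (∀ {d} → d < n → IsUnit (Φ (suc d) 0)) → IsUnit (Φ (suc n) 0)
  step n IH = ≡.subst IsUnit (≡.sym (Φ-unfold n 0))
    (IsUnit-⊛ (xPowMinusOne (suc n)) (∏∣′ (suc n) (inv ∘ Φ)) (inj₂ refl)
      (IsUnit-∏ n _ (λ d d<n → IsUnit-when (suc d ∣? suc n) (inv (Φ (suc d))) (IH d<n))))

∏∣-Φ : ∀ n .{{_ : NonZero n}} → ∏∣ n Φ ≗ xPowMinusOne n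
∏∣-Φ (suc n) = begin
  ∏∣ (suc n) Φ                                   ≈⟨ ∏∣-suc n Φ ⟩
  ∏∣′ (suc n) Φ ⊛ Φ (suc n)                      ≈⟨ ⊛-congˡ {∏∣′ (suc n) Φ} (Φ-unfold n) ⟩
  ∏∣′ (suc n) Φ ⊛ (X ⊛ ∏∣′ (suc n) (inv ∘ Φ))    ≈⟨ x⊛[y⊛z]≗y⊛[x⊛z] (∏∣′ (suc n) Φ) X _ ⟩
  X ⊛ (∏∣′ (suc n) Φ ⊛ ∏∣′ (suc n) (inv ∘ Φ))    ≈⟨ ⊛-congˡ {X} (∏∣′-∙ (suc n) Φ (inv ∘ Φ)) ⟩
  X ⊛ ∏∣′ (suc n) Φ⊛Φ⁻¹                          ≈⟨ ⊛-congˡ {X} (∏∣′-ε (suc n) Φ⊛Φ⁻¹ Φ⊛Φ⁻¹≗one) ⟩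
  X ⊛ one                                        ≈⟨ ⊛-identityʳ X ⟩
  X                                              ∎
  where
  open ≗-Reasoning
  X : Series
  X = xPowMinusOne (suc n)
  Φ⊛Φ⁻¹ : ℕ → Series
  Φ⊛Φ⁻¹ d = Φ d ⊛ inv (Φ d)
  Φ⊛Φ⁻¹≗one : ∀ d → Φ⊛Φ⁻¹ (suc d) ≗ one
  Φ⊛Φ⁻¹≗one d = ⊛-inverseʳ (Φ (suc d)) (IsUnit-Φ (suc d))

∏∣-injective : ∀ (F G : ℕ → Series) → (∀ d → IsUnit (F (suc d) 0)) →
               (∀ n → ∏∣ (suc n) F ≗ ∏∣ (suc n) G) → ∀ n → F (suc n) ≗ G (suc n)
∏∣-injective F G F-unit ∏F≗∏G = <-rec (λ n → F (suc n) ≗ G (suc n)) step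
  where
  step : ∀ n → (∀ {d} → d < n → F (suc d) ≗ G (suc d)) → F (suc n) ≗ G (suc n)
  step n IH = ⊛-cancelˡ (∏∣′ (suc n) F) {F (suc n)} {G (suc n)}
    (IsUnit-∏ n _ (λ d _ → IsUnit-when (suc d ∣? suc n) (F (suc d)) (F-unit d))) (begin
      ∏∣′ (suc n) F ⊛ F (suc n)   ≈⟨ ∏∣-suc n F ⟨
      ∏∣ (suc n) F                ≈⟨ ∏F≗∏G n ⟩
      ∏∣ (suc n) G                ≈⟨ ∏∣-suc n G ⟩
      ∏∣′ (suc n) G ⊛ G (suc n)   ≈⟨ ⊛-congʳ (∏∣′-cong n {G} {F} (λ d d<n → ≗-sym (IH d<n))) ⟩
      ∏∣′ (suc n) F ⊛ G (suc n)   ∎)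
    where open ≗-Reasoning

module _ {p} (p-prime : Prime p) where

  private instance
    p≢0 : NonZero p
    p≢0 = prime⇒nonZero p-prime

  Ψ : ℕ → Series
  Ψ d = Φ (d ℕ.* p) ⊛ when (¬? (p ∣? d)) (Φ d)

  ∏∣-Ψ : ∀ n → ∏∣ (suc n) Ψ ≗ ∏∣ (suc n) (dilate p ∘ Φ)
  ∏∣-Ψ n = begin
    ∏∣ (suc n) Ψ                        ≈⟨ ∏∣-*-prime p-prime (suc n) Φ ⟨
    ∏∣ (suc n ℕ.* p) Φ                  ≈⟨ ∏∣-Φ (suc n ℕ.* p) {{ℕ.m*n≢0 (suc n) p}} ⟩
    xPowMinusOne (suc n ℕ.* p)          ≈⟨ dilate-xPowMinusOne p (suc n) ⟨
    dilate p (xPowMinusOne (suc n))     ≈⟨ dilate-cong p (∏∣-Φ (suc n)) ⟨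
    dilate p (∏∣ (suc n) Φ)             ≈⟨ dilate-∏∣ p (suc n) Φ ⟩
    ∏∣ (suc n) (dilate p ∘ Φ)           ∎
    where open ≗-Reasoning

  Ψ≗dilate-Φ : ∀ n → Ψ (suc n) ≗ dilate p (Φ (suc n))
  Ψ≗dilate-Φ = ∏∣-injective Ψ (dilate p ∘ Φ) Ψ-unit ∏∣-Ψ
    where
    Ψ-unit : ∀ d → IsUnit (Ψ (suc d) 0)
    Ψ-unit d = IsUnit-⊛ (Φ (suc d ℕ.* p)) (when (¬? (p ∣? suc d)) (Φ (suc d)))
      (IsUnit-Φ (suc d ℕ.* p) {{ℕ.m*n≢0 (suc d) p}})
      (IsUnit-when (¬? (p ∣? suc d)) (Φ (suc d)) (IsUnit-Φ (suc d)))

  Φ-*-prime : ∀ n .{{_ : NonZero n}} → p ∣ n → Φ (n ℕ.* p) ≗ dilate p (Φ n)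
  Φ-*-prime (suc n) p∣n = begin
    Φ (suc n ℕ.* p)          ≈⟨ ⊛-identityʳ (Φ (suc n ℕ.* p)) ⟨
    Φ (suc n ℕ.* p) ⊛ one    ≈⟨ ⊛-congˡ {Φ (suc n ℕ.* p)} (when-no (¬? (p ∣? suc n)) (λ p∤n → p∤n p∣n)) ⟨
    Ψ (suc n)                ≈⟨ Ψ≗dilate-Φ n ⟩
    dilate p (Φ (suc n))     ∎
    where open ≗-Reasoning

Φ-*-product : ∀ m .{{_ : NonZero m}} ps (ps-prime : All Prime ps) → All (_∣ m) ps →
              Φ (m ℕ.* product ps) ≗ dilate (product ps) {{productOfPrimes≢0 ps-prime}} (Φ m)
Φ-*-product m []       []                   []            = begin
  Φ (m ℕ.* 1)      ≡⟨ cong Φ (ℕ.*-identityʳ m) ⟩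
  Φ m              ≈⟨ dilate-1 (Φ m) ⟨
  dilate 1 (Φ m)   ∎
  where open ≗-Reasoning
Φ-*-product m (p ∷ ps) (p-prime ∷ ps-prime) (p∣m ∷ ps∣m) = begin
  Φ (m ℕ.* (p ℕ.* P))               ≡⟨ cong Φ (≡.sym (ℕ.*-assoc m p P)) ⟩
  Φ (m ℕ.* p ℕ.* P)                 ≈⟨ Φ-*-product (m ℕ.* p) {{ℕ.m*n≢0 m p}} ps ps-prime ps∣mp ⟩
  dilate P (Φ (m ℕ.* p))            ≈⟨ dilate-cong P (Φ-*-prime p-prime m p∣m) ⟩
  dilate P (dilate p (Φ m))         ≈⟨ dilate-dilate P p (Φ m) ⟩
  dilate (p ℕ.* P) {{pP≢0}} (Φ m)   ∎
  where
  open ≗-Reasoning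
  P : ℕ
  P = product ps
  instance
    p≢0 : NonZero p
    p≢0 = prime⇒nonZero p-prime
    P≢0 : NonZero P
    P≢0 = productOfPrimes≢0 ps-prime
  pP≢0 : NonZero (p ℕ.* P)
  pP≢0 = ℕ.m*n≢0 p P
  ps∣mp : All (_∣ m ℕ.* p) ps
  ps∣mp = All.map (λ q∣m → ∣-trans q∣m (m∣m*n p)) ps∣m

Φ-*-dilate : ∀ m t .{{_ : NonZero m}} .{{_ : NonZero t}} → (∀ {q} → Prime q → q ∣ t → q ∣ m) →
             Φ (m ℕ.* t) ≗ dilate t (Φ m)
Φ-*-dilate m t primes∣m with factorise t
... | record { factors = qs ; isFactorisation = refl ; factorsPrime = qs-prime } =
  Φ-*-product m qs qs-prime (All.tabulate (λ q∈qs →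
    primes∣m (All.lookup qs-prime q∈qs) (∈⇒∣product q∈qs)))

module _ (k t : ℕ) .{{_ : NonZero k}} .{{_ : NonZero t}}
         (primes∣k : ∀ {q} → Prime q → q ∣ t → q ∣ k) where

  private
    Φ-dilate : ∀ n → Φ (t ℕ.* k ℕ.* suc n) ≗ dilate t (Φ (k ℕ.* suc n))
    Φ-dilate n = ≗-trans (≗-reflexive (cong Φ (rearrange t k (suc n))))
      (Φ-*-dilate (k ℕ.* suc n) t {{ℕ.m*n≢0 k (suc n)}}
        (λ q-prime q∣t → ∣-trans (primes∣k q-prime q∣t) (m∣m*n (suc n))))
      where
      rearrange : ∀ t k n → t ℕ.* k ℕ.* n ≡ k ℕ.* n ℕ.* t
      rearrange = ℕ-Solver.solve-∀

    smaller-index : ∀ n → k ℕ.* suc (ℕ.pred (t ℕ.* suc n)) ≡ t ℕ.* k ℕ.* suc n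
    smaller-index n =
      ≡.trans (cong (k ℕ.*_) (ℕ.suc-pred (t ℕ.* suc n) {{ℕ.m*n≢0 t (suc n)}})) (rearrange k t (suc n))
      where
      rearrange : ∀ k t n → k ℕ.* (t ℕ.* n) ≡ t ℕ.* k ℕ.* n
      rearrange = ℕ-Solver.solve-∀

  S[t*k]⇔S[k] : ∀ z → S (t ℕ.* k) z ⇔ S k z
  S[t*k]⇔S[k] z = mk⇔
    (λ (n , j , a≡z) → ℕ.pred (t ℕ.* suc n) , j , ≡.trans (cong (λ N → a N j) (smaller-index n)) a≡z)
    (λ (n , j , a≡z) → n , j ℕ.* t , (begin
      a (t ℕ.* k ℕ.* suc n) (j ℕ.* t)         ≡⟨ Φ-dilate n (j ℕ.* t) ⟩
      dilate t (a (k ℕ.* suc n)) (j ℕ.* t)    ≡⟨ dilate-* t (a (k ℕ.* suc n)) j ⟩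
      a (k ℕ.* suc n) j                       ≡⟨ a≡z ⟩
      z                                       ∎))
    where open ≡.≡-Reasoning

  R[t*k]⇔R[k] : ∀ z → R (t ℕ.* k) z ⇔ R k z
  R[t*k]⇔R[k] z = mk⇔
    (λ (n , j , c≡z) → ℕ.pred (t ℕ.* suc n) , j , ≡.trans (cong (λ N → c N j) (smaller-index n)) c≡z)
    (λ (n , j , c≡z) → n , j ℕ.* t , (begin
      c (t ℕ.* k ℕ.* suc n) (j ℕ.* t)              ≡⟨ inv-cong (Φ-dilate n) (j ℕ.* t) ⟩
      inv (dilate t (Φ (k ℕ.* suc n))) (j ℕ.* t)   ≡⟨ dilate-inv t (Φ (k ℕ.* suc n)) Φ[kn]-unit (j ℕ.* t) ⟨
      dilate t (c (k ℕ.* suc n)) (j ℕ.* t)         ≡⟨ dilate-* t (c (k ℕ.* suc n)) j ⟩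
      c (k ℕ.* suc n) j                            ≡⟨ c≡z ⟩
      z                                            ∎))
    where
    open ≡.≡-Reasoning
    Φ[kn]-unit : ∀ {n} → IsUnit (Φ (k ℕ.* suc n) 0)
    Φ[kn]-unit {n} = IsUnit-Φ (k ℕ.* suc n) {{ℕ.m*n≢0 k (suc n)}}

corollary1 : (m : ℕ) → m ≥ 1 →
    ((z : ℤ) → S m z ⇔ S (κ m) z) × ((z : ℤ) → R m z ⇔ R (κ m) z)
corollary1 m@(suc _) _ with κ∣ m
... | divides t m≡t*k =
  ≡.subst (λ M → ((z : ℤ) → S M z ⇔ S k z) × ((z : ℤ) → R M z ⇔ R k z)) (≡.sym m≡t*k)
    (S[t*k]⇔S[k] k t primes∣k , R[t*k]⇔R[k] k t primes∣k)
  where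
  k : ℕ
  k = κ m
  instance
    tk≢0 : NonZero (t ℕ.* k)
    tk≢0 = ≡.subst NonZero m≡t*k _
    t≢0 : NonZero t
    t≢0 = ℕ.m*n≢0⇒m≢0 t
    k≢0 : NonZero k
    k≢0 = ℕ.m*n≢0⇒n≢0 t
  primes∣k : ∀ {q} → Prime q → q ∣ t → q ∣ k
  primes∣k q-prime q∣t = prime∣⇒∣κ m q-prime (∣-trans q∣t (divides k (≡.trans m≡t*k (ℕ.*-comm t k))))
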